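{- For every type $A$, the following are equivalent: (1) $A$ is discrete; (2) for every $a_0:A$, the map $\Sigma\text{ -isolate}_{A,\,a_0=(-)}:\sum_{a:A^{\circ}}(a_0=a)^{\circ}\to\big(\sum_{a:A}(a_0=a)\big)^{\circ}$ is an equivalence.
   Context: Work in Homotopy Type Theory with a univalent universe. A type is discrete if its equality is decidable. A point $a:A$ is isolated if $a=b$ is decidable for all $b:A$; $A^{\circ}$ is the subtype of isolated points. For $A:\mathsf{Type}$, $B:A\to\mathsf{Type}$, the map $\Sigma\text{ -isolate}_{A,B}:\sum_{a:A^{\circ}}(B(a))^{\circ}\to(\sum_{a:A}B(a))^{\circ}$ sends a pair of isolated points $(a,b)$ to $(a,b)$, which is isolated in the $\Sigma$-type. -}

{-# OPTIONS --without-K #-}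
module Defs where

open import Level using (Level; _⊔_)
open import Data.Product using (Σ; _,_; proj₁; proj₂)
open import Data.Empty using (⊥-elim)
open import Relation.Nullary using (Dec; yes; no; ¬_)
open import Relation.Binary.PropositionalEquality
  using (_≡_; refl; sym; trans; cong; subst)

private variable
  ℓ ℓ' : Level

isContr : Set ℓ → Set ℓ
isContr X = Σ X λ c → ∀ x → c ≡ x

fiber : {X : Set ℓ} {Y : Set ℓ'} → (X → Y) → Y → Set (ℓ ⊔ ℓ')
fiber {X = X} f y = Σ X λ x → f x ≡ y

isEquiv : {X : Set ℓ} {Y : Set ℓ'} → (X → Y) → Set (ℓ ⊔ ℓ')
isEquiv {Y = Y} f = ∀ (y : Y) → isContr (fiber f y)

isIsolated : {X : Set ℓ} → X → Set ℓ
isIsolated {X = X} x = ∀ (y : X) → Dec (x ≡ y)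

_° : Set ℓ → Set ℓ
X ° = Σ X isIsolated

isDiscrete : Set ℓ → Set ℓ
isDiscrete X = ∀ (x y : X) → Dec (x ≡ y)

-- local Hedberg: paths out of an isolated point are unique
module _ {X : Set ℓ} {x : X} (dx : isIsolated x) where
  private
    norm : ∀ {y} → x ≡ y → x ≡ y
    norm {y} q with dx y
    ... | yes p = p
    ... | no n = ⊥-elim (n q)

    norm-const : ∀ {y} (p q : x ≡ y) → norm p ≡ norm q
    norm-const {y} p q with dx y
    ... | yes _ = refl
    ... | no n = ⊥-elim (n p)

    canon : ∀ {y} (p : x ≡ y) → p ≡ trans (sym (norm refl)) (norm p)
    canon refl = lemma (norm refl)
      where
      lemma : ∀ {z} (r : x ≡ z) → refl ≡ trans (sym r) r
      lemma refl = refl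

  isolated-paths : ∀ {y} (p q : x ≡ y) → p ≡ q
  isolated-paths p q =
    trans (canon p) (trans (cong (trans (sym (norm refl))) (norm-const p q)) (sym (canon q)))

module _ {A : Set ℓ} {B : A → Set ℓ'} where
  private
    snd-path : ∀ {x y : Σ A B} (e : x ≡ y) → subst B (cong proj₁ e) (proj₂ x) ≡ proj₂ y
    snd-path refl = refl

  isolated-pair : ∀ {a : A} {b : B a} → isIsolated a → isIsolated b
                → isIsolated {X = Σ A B} (a , b)
  isolated-pair {a} {b} da db (a' , b') with da a'
  ... | no n = no λ e → n (cong proj₁ e)
  ... | yes p = helper p b'
    where
    helper : ∀ {a''} (p : a ≡ a'') (c : B a'') → Dec ((a , b) ≡ (a'' , c))
    helper refl c with db c
    ... | yes q = yes (cong (a ,_) q)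
    ... | no n = no λ e → n (subst (λ r → subst B r b ≡ c)
                                   (isolated-paths da (cong proj₁ e) refl)
                                   (snd-path e))

  Σ-isolate : Σ (A °) (λ a → (B (proj₁ a)) °) → (Σ A B) °
  Σ-isolate ((a , ia) , (b , ib)) = (a , b) , isolated-pair ia ib

module Submission where

-- Both sides of Σ-isolate are propositions whatever A is: a path a₀ ≡ a lets
-- us identify a with a₀, and being isolated is a proposition (function
-- extensionality plus local Hedberg). A map between propositions is an
-- equivalence exactly when its domain is inhabited, and the domain is
-- inhabited exactly when a₀ is isolated. So Σ-isolate is an equivalence at a₀
-- iff a₀ is isolated, and discreteness says that every point is.

open import Defs
open import Level using (Level; 0ℓ)
open import Function.Bundles using (_⇔_; mk⇔; Equivalence)
open import Relation.Binary.PropositionalEquality using (_≡_; refl; sym; cong; cong₂; subst)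
open import Axiom.Extensionality.Propositional using (Extensionality; lower-extensionality)
open import Axiom.UniquenessOfIdentityProofs using (UIP)
open import Data.Product using (Σ; _,_; proj₁; proj₂)
open import Data.Product.Properties using (Σ-≡,≡→≡)
open import Data.Empty using (⊥-elim)
open import Relation.Nullary using (Dec; yes; no)
open import Relation.Nullary.Irrelevant using (Irrelevant)

private variable
  ℓ ℓ' : Level

Irrelevant⇒isIsolated : {X : Set ℓ} → Irrelevant X → (x : X) → isIsolated x
Irrelevant⇒isIsolated irr x y = yes (irr x y)

Irrelevant⇒UIP : {X : Set ℓ} → Irrelevant X → UIP X
Irrelevant⇒UIP irr {x} = isolated-paths (Irrelevant⇒isIsolated irr x)

Σ-irrelevant : {X : Set ℓ} {B : X → Set ℓ'} →
               Irrelevant X → (∀ x → Irrelevant (B x)) → Irrelevant (Σ X B)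
Σ-irrelevant irrX irrB (x , b) (x' , b') = Σ-≡,≡→≡ (irrX x x' , irrB x' _ _)

singleton-irrelevant : {X : Set ℓ} (x₀ : X) → Irrelevant (Σ X (x₀ ≡_))
singleton-irrelevant x₀ (_ , refl) (_ , refl) = refl

isEquiv-between-irrelevant : {X : Set ℓ} {Y : Set ℓ'} → Irrelevant X → Irrelevant Y →
                             X → (f : X → Y) → isEquiv f
isEquiv-between-irrelevant irrX irrY x f y =
  (x , irrY (f x) y) , λ (x' , _) → Σ-≡,≡→≡ (irrX x x' , Irrelevant⇒UIP irrY _ _)

module _ (fe : Extensionality ℓ ℓ) where

  Dec-irrelevant : {P : Set ℓ} → Irrelevant P → Irrelevant (Dec P)
  Dec-irrelevant irr (yes p) (yes q) = cong yes (irr p q)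
  Dec-irrelevant irr (yes p) (no ¬q) = ⊥-elim (¬q p)
  Dec-irrelevant irr (no ¬p) (yes q) = ⊥-elim (¬p q)
  Dec-irrelevant irr (no ¬p) (no ¬q) =
    cong no (lower-extensionality 0ℓ ℓ fe λ p → ⊥-elim (¬p p))

  isIsolated-irrelevant : {X : Set ℓ} {x : X} → Irrelevant (isIsolated x)
  isIsolated-irrelevant i j = fe λ y → Dec-irrelevant (isolated-paths i) (i y) (j y)

  °-irrelevant : {X : Set ℓ} → Irrelevant X → Irrelevant (X °)
  °-irrelevant irr = Σ-irrelevant irr λ _ → isIsolated-irrelevant

  module _ {A : Set ℓ} (a₀ : A) where

    Σ-isolate-domain-irrelevant : Irrelevant (Σ (A °) λ a → (a₀ ≡ proj₁ a) °)
    Σ-isolate-domain-irrelevant ((_ , i) , refl , j) ((_ , i') , refl , j') =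
      cong₂ (λ i j → (a₀ , i) , refl , j) (isIsolated-irrelevant i i') (isIsolated-irrelevant j j')

    Σ-isolate-codomain-irrelevant : Irrelevant ((Σ A (a₀ ≡_)) °)
    Σ-isolate-codomain-irrelevant = °-irrelevant (singleton-irrelevant a₀)

    Σ-isolate-isEquiv⇔isIsolated : isEquiv (Σ-isolate {A = A} {B = a₀ ≡_}) ⇔ isIsolated a₀
    Σ-isolate-isEquiv⇔isIsolated = mk⇔ to from
      where
      to : isEquiv (Σ-isolate {A = A} {B = a₀ ≡_}) → isIsolated a₀
      to equiv with proj₁ (equiv ((a₀ , refl) , Irrelevant⇒isIsolated (singleton-irrelevant a₀) _))
      ... | ((a , isolated) , a₀≡a , _) , _ = subst isIsolated (sym a₀≡a) isolated

      from : isIsolated a₀ → isEquiv (Σ-isolate {A = A} {B = a₀ ≡_})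
      from isolated =
        isEquiv-between-irrelevant Σ-isolate-domain-irrelevant Σ-isolate-codomain-irrelevant
          ((a₀ , isolated) , refl , Irrelevant⇒isIsolated (isolated-paths isolated) refl)
          Σ-isolate

proposition2p16 : ∀ {ℓ : Level} → Extensionality ℓ ℓ → (A : Set ℓ)
    → isDiscrete A ⇔ (∀ (a₀ : A) → isEquiv (Σ-isolate {A = A} {B = λ a → a₀ ≡ a}))
proposition2p16 fe A = mk⇔
  (λ discrete a₀ → Equivalence.from (Σ-isolate-isEquiv⇔isIsolated fe a₀) (discrete a₀))
  (λ equiv a₀ → Equivalence.to (Σ-isolate-isEquiv⇔isIsolated fe a₀) (equiv a₀))
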